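{- Let $G=(V,E)$ be a connected undirected signed graph. Then $\mathrm{Comp}_{\mathrm{DPE}}\subseteq\mathrm{Comp}_{\mathrm{SPA}}\subseteq\mathrm{Comp}_{\mathrm{SPM}}\subseteq\mathrm{Comp}_{\mathrm{SPO}}\subseteq\mathrm{Comp}_{\mathrm{SBP}}\subseteq\mathrm{Comp}_{\mathrm{NNE}}$, where these relations on $V\times V$ are defined as follows: $\mathrm{Comp}_{\mathrm{DPE}}=\{(u,v): (u,v,+1)\in E\}$; $\mathrm{Comp}_{\mathrm{SPA}}=\{(u,v): \text{every } P\in SP_{uv} \text{ has } \mathrm{sign}(P)=+1\}$; $\mathrm{Comp}_{\mathrm{SPM}}=\{(u,v): |SP^+_{uv}|\ge |SP^-_{uv}|\}$; $\mathrm{Comp}_{\mathrm{SPO}}=\{(u,v): \text{some } P\in SP_{uv} \text{ has } \mathrm{sign}(P)=+1\}$; $\mathrm{Comp}_{\mathrm{SBP}}=\{(u,v): \text{some } P\in BP_{uv} \text{ has } \mathrm{sign}(P)=+1\}$; $\mathrm{Comp}_{\mathrm{NNE}}=\{(u,v): (u,v,-1)\notin E\}$.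
   Context: An undirected signed graph is $G=(V,E)$ with $E\subseteq\{(u,v,\ell): u,v\in V,\ \ell\in\{+1,-1\}\}$, each pair of distinct nodes joined by at most one edge; $\mathrm{sign}(u,v)=\ell$ is the label of edge $(u,v,\ell)$. A path $P=(v_0,\dots,v_{k+1})$ between $v_0$ and $v_{k+1}$ is a sequence of nodes with $(v_i,v_{i+1})\in E$ for all $i$; its sign is $\mathrm{sign}(P)=\prod_{i=0}^{k}\mathrm{sign}(v_i,v_{i+1})$ (positive if $+1$, negative if $-1$). $SP_{uv}$ is the set of shortest paths between $u$ and $v$, and $SP^+_{uv}$, $SP^-_{uv}$ are its positive and negative members. A signed graph is structurally balanced if it contains no cycle with an odd number of negative edges. For a path $P$, $G_P$ is the subgraph of $G$ induced by the nodes of $P$; $P$ is structurally balanced if $G_P$ is structurally balanced, and $BP_{uv}$ denotes the set of structurally balanced paths between $u$ and $v$. -}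

module Defs where

open import Data.Nat using (ℕ; zero; suc; _+_; _≤_; _%_)
open import Data.Fin using (Fin)
open import Data.Maybe using (Maybe; just; nothing)
open import Data.List using (List; []; _∷_; _++_; length; head; last)
open import Data.List.Membership.Propositional using (_∈_)
open import Data.List.Relation.Unary.All using (All)
open import Data.List.Relation.Unary.Unique.Propositional using (Unique)
open import Data.Product using (Σ; ∃; _×_; _,_)
open import Data.Unit using (⊤)
open import Data.Empty using (⊥)
open import Relation.Binary.PropositionalEquality using (_≡_)
open import Relation.Nullary using (¬_)

data Sign : Set where
  plus minus : Sign

_·_ : Sign → Sign → Sign
plus  · s = s
minus · plus = minus
minus · minus = plus

-- An undirected signed graph on the finite node set Fin n:
-- edge u v = just ℓ  iff  (u,v,ℓ) ∈ E ; at most one edge per pair,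
-- symmetric (undirected), no loops (edges join distinct nodes).
record SignedGraph (n : ℕ) : Set where
  field
    edge   : Fin n → Fin n → Maybe Sign
    sym    : ∀ u v → edge u v ≡ edge v u
    irrefl : ∀ u → edge u u ≡ nothing

module _ {n : ℕ} (G : SignedGraph n) where
  open SignedGraph G

  V : Set
  V = Fin n

  Adj : V → V → Set
  Adj u v = ∃ λ ℓ → edge u v ≡ just ℓ

  Chain : List V → Set
  Chain []           = ⊤
  Chain (x ∷ [])     = ⊤
  Chain (x ∷ y ∷ xs) = Adj x y × Chain (y ∷ xs)

  IsPath : V → V → List V → Set
  IsPath u v P = head P ≡ just u × last P ≡ just v × Chain P

  -- sign of an edge (only ever used on actual edges)
  signE : V → V → Sign
  signE x y with edge x y
  ... | just ℓ  = ℓ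
  ... | nothing = plus

  signP : List V → Sign
  signP []           = plus
  signP (x ∷ [])     = plus
  signP (x ∷ y ∷ xs) = signE x y · signP (y ∷ xs)

  negE : V → V → ℕ
  negE x y with edge x y
  ... | just minus = 1
  ... | _          = 0

  negCount : List V → ℕ
  negCount []           = 0
  negCount (x ∷ [])     = 0
  negCount (x ∷ y ∷ xs) = negE x y + negCount (y ∷ xs)

  -- P ∈ SP_uv (path length = number of nodes - 1, so comparing node counts suffices)
  Shortest : V → V → List V → Set
  Shortest u v P = IsPath u v P × (∀ Q → IsPath u v Q → length P ≤ length Q)

  IsCycle : List V → Set
  IsCycle []       = ⊥
  IsCycle (x ∷ xs) = Unique (x ∷ xs) × 3 ≤ length (x ∷ xs) × Chain ((x ∷ xs) ++ (x ∷ []))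

  NegCycle : List V → Set
  NegCycle [] = ⊥
  NegCycle (x ∷ xs) = IsCycle (x ∷ xs) × negCount ((x ∷ xs) ++ (x ∷ [])) % 2 ≡ 1

  -- G_P (subgraph induced by the nodes of P) is structurally balanced:
  -- no cycle of G all of whose nodes lie in P has an odd number of negative edges
  BalancedPath : List V → Set
  BalancedPath P = ¬ (∃ λ C → All (λ w → w ∈ P) C × NegCycle C)

  HasCard : (List V → Set) → ℕ → Set
  HasCard A k = Σ (List (List V)) λ L →
    Unique L × (∀ P → (P ∈ L → A P) × (A P → P ∈ L)) × length L ≡ k

  Connected : Set
  Connected = ∀ u v → ∃ λ P → IsPath u v P

  CompDPE CompSPA CompSPM CompSPO CompSBP CompNNE : V → V → Set
  CompDPE u v = edge u v ≡ just plus
  CompSPA u v = ∀ P → Shortest u v P → signP P ≡ plus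
  CompSPM u v = ∃ λ p → ∃ λ m →
    HasCard (λ P → Shortest u v P × signP P ≡ plus) p ×
    HasCard (λ P → Shortest u v P × signP P ≡ minus) m × m ≤ p
  CompSPO u v = ∃ λ P → Shortest u v P × signP P ≡ plus
  CompSBP u v = ∃ λ P → IsPath u v P × BalancedPath P × signP P ≡ plus
  CompNNE u v = ¬ (edge u v ≡ just minus)

  _⊆ᵣ_ : (V → V → Set) → (V → V → Set) → Set
  R ⊆ᵣ S = ∀ u v → R u v → S u v

-- A positive edge uv is itself the only shortest path from u to v. Shortest paths are no
-- longer than any given path, so they form a finite set, obtained by enumerating node
-- sequences: a shortest path exists, and if negative shortest paths are at most as many as
-- positive ones, a negative one forces a positive one. A shortest path P has no chords, so
-- the positions of its nodes change by exactly one along every edge inside P; a cycle on the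
-- nodes of P would then be monotone and could not close, hence P is balanced. Finally, a
-- positive path from u to v closed by a negative edge vu is a negative closed walk; cutting
-- it at a repeated node gives two shorter closed walks whose signs multiply to minus, so one
-- of them is negative, and iterating ends in a negative cycle on the nodes of the path.
module Submission where

open import Data.Empty using (⊥-elim)
open import Data.Fin using () renaming (_≟_ to _≟ᶠ_)
open import Data.List using (List; []; _∷_; _++_; [_]; length; head; last; filter; deduplicate; cartesianProductWith; allFin; initLast; _∷ʳ′_)
open import Data.List.Extrema.Nat using (argmin; argmin-all; f[argmin]≤v⁺; f[argmin]≤f[⊤])
open import Data.List.Membership.Propositional using (_∈_; lose)
open import Data.List.Membership.Propositional.Properties using (∈-∃++; ∈-allFin; ∈-cartesianProductWith⁺; ∈-filter⁺; ∈-filter⁻; ∈-deduplicate⁺; ∈-deduplicate⁻)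
open import Data.List.Properties using (++-assoc; length-++; ∷-injectiveʳ) renaming (≡-dec to ≡-decᴸ)
open import Data.List.Relation.Unary.All as All using (All; _∷_)
open import Data.List.Relation.Unary.All.Properties using (++⁺; ++⁻ˡ; ++⁻ʳ; ¬Any⇒All¬; all-filter)
open import Data.List.Relation.Unary.Any as Any using (here; there; any?)
open import Data.List.Relation.Unary.Linked using (Linked; []; [-]; _∷_)
open import Data.List.Relation.Unary.Unique.Propositional using (Unique)
open import Data.List.Relation.Unary.Unique.DecPropositional.Properties using (deduplicate-!)
open import Data.List.Relation.Unary.AllPairs using ([]; _∷_)
open import Data.Maybe using (just; nothing)
open import Data.Maybe.Properties using () renaming (≡-dec to ≡-decᴹ)
open import Data.Nat using (ℕ; zero; suc; _+_; _≤_; _<_; _%_; _≤?_; z≤n; s≤s)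
open import Data.Nat.Induction using (<-wellFounded)
open import Data.Nat.Properties using (≤-refl; ≤-reflexive; ≤-trans; <-trans; <-irrefl; <-asym; <⇒≤; <⇒≱; ≰⇒>; <-≤-trans; <-cmp; m≤n+m; m<m+n; m<n+m; +-suc; +-comm; suc-injective; n<1+n)
open import Data.Product using (∃; ∃₂; _×_; _,_; proj₁; proj₂)
open import Data.Sum as Sum using (_⊎_; inj₁; inj₂; [_,_]′)
open import Data.Unit using (tt)
open import Function using (_∘_; flip; id; case_of_)
open import Induction.WellFounded using (Acc; acc)
open import Relation.Binary.Definitions using (DecidableEquality; tri<; tri≈; tri>)
open import Relation.Binary.PropositionalEquality using (_≡_; refl; sym; trans; cong; cong₂; subst; subst₂; module ≡-Reasoning)
open import Relation.Nullary using (¬_; Dec; yes; no)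
open import Relation.Nullary.Decidable using (_×-dec_; map′)
open import Relation.Unary using (Decidable)
open import Defs

·-assoc : ∀ a b c → (a · b) · c ≡ a · (b · c)
·-assoc plus  b     c = refl
·-assoc minus plus  c = refl
·-assoc minus minus plus  = refl
·-assoc minus minus minus = refl

·-leftComm : ∀ a b c → a · (b · c) ≡ b · (a · c)
·-leftComm plus  b     c = refl
·-leftComm minus plus  c = refl
·-leftComm minus minus c = refl

·-identityʳ : ∀ a → a · plus ≡ a
·-identityʳ plus  = refl
·-identityʳ minus = refl

·-selfInverse : ∀ a → a · a ≡ plus
·-selfInverse plus  = refl
·-selfInverse minus = refl

·≡minus : ∀ a b → a · b ≡ minus → a ≡ minus ⊎ b ≡ minus
·≡minus plus  b ab = inj₂ ab
·≡minus minus b ab = inj₁ refl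

plus≢minus : ¬ plus ≡ minus
plus≢minus ()

_≟ˢ_ : DecidableEquality Sign
plus  ≟ˢ plus  = yes refl
plus  ≟ˢ minus = no λ ()
minus ≟ˢ plus  = no λ ()
minus ≟ˢ minus = yes refl

infix 30 minus^_

minus^_ : ℕ → Sign
minus^ zero  = plus
minus^ suc k = minus · minus^ k

minus^-+ : ∀ a b → minus^ (a + b) ≡ minus^ a · minus^ b
minus^-+ zero    b = refl
minus^-+ (suc a) b = trans (cong (minus ·_) (minus^-+ a b)) (sym (·-assoc minus (minus^ a) (minus^ b)))

minus^≡minus⇒odd : ∀ k → minus^ k ≡ minus → k % 2 ≡ 1
minus^≡minus⇒odd (suc zero)    _  = refl
minus^≡minus⇒odd (suc (suc k)) eq = minus^≡minus⇒odd k (trans (·-assoc minus minus (minus^ k)) eq)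

module _ {A : Set} where

  head-++-∷ : ∀ xs (w : A) ys zs → head (xs ++ w ∷ ys) ≡ head (xs ++ w ∷ zs)
  head-++-∷ []      w ys zs = refl
  head-++-∷ (x ∷ _) w ys zs = refl

  last-++-∷ : ∀ xs (w : A) ys → last (xs ++ w ∷ ys) ≡ last (w ∷ ys)
  last-++-∷ []           w ys = refl
  last-++-∷ (x ∷ [])     w ys = refl
  last-++-∷ (x ∷ y ∷ xs) w ys = last-++-∷ (y ∷ xs) w ys

  ++-loop-assoc : ∀ as (w : A) bs cs ys → (as ++ w ∷ bs ++ w ∷ cs) ++ ys ≡ as ++ w ∷ bs ++ w ∷ cs ++ ys
  ++-loop-assoc as w bs cs ys = trans (++-assoc as _ ys) (cong (λ t → as ++ w ∷ t) (++-assoc bs (w ∷ cs) ys))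

  length-loop : ∀ as (w : A) bs cs → length (as ++ w ∷ bs ++ w ∷ cs) ≡ length (w ∷ bs) + length (as ++ w ∷ cs)
  length-loop []       w bs cs = cong suc (length-++ bs)
  length-loop (a ∷ as) w bs cs = trans (cong suc (length-loop as w bs cs)) (sym (+-suc (length (w ∷ bs)) _))

  All-loop : ∀ {P : A → Set} as w bs cs → All P (as ++ w ∷ bs ++ w ∷ cs) → All P (w ∷ bs) × All P (as ++ w ∷ cs)
  All-loop as w bs cs ps with ++⁻ʳ as ps
  ... | pw ∷ rest = pw ∷ ++⁻ˡ bs {w ∷ cs} rest , ++⁺ (++⁻ˡ as ps) (pw ∷ All.tail (++⁻ʳ bs rest))

  data Repeats : List A → Set where
    repeats : ∀ as w bs cs → Repeats (as ++ w ∷ bs ++ w ∷ cs)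

  unique⊎repeats : DecidableEquality A → (xs : List A) → Unique xs ⊎ Repeats xs
  unique⊎repeats _≟_ [] = inj₁ []
  unique⊎repeats _≟_ (x ∷ xs) with any? (x ≟_) xs
  ... | yes x∈xs with ys , zs , refl ← ∈-∃++ x∈xs = inj₂ (repeats [] x ys zs)
  ... | no x∉xs with unique⊎repeats _≟_ xs
  ...   | inj₁ unique              = inj₁ (¬Any⇒All¬ xs x∉xs ∷ unique)
  ...   | inj₂ (repeats as w bs cs) = inj₂ (repeats (x ∷ as) w bs cs)

  split-between : ∀ {a b : A} ys zs ys' zs' → length ys < length ys' → ys ++ a ∷ zs ≡ ys' ++ b ∷ zs' →
    ∃ λ ms → zs ≡ ms ++ b ∷ zs' × length ys' ≡ length ys + suc (length ms)
  split-between []       zs (c ∷ cs) zs' _         refl = cs , refl , refl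
  split-between (y ∷ ys) zs (c ∷ cs) zs' (s≤s lt) eq
    with ms , zs≡ , len ← split-between ys zs cs zs' lt (∷-injectiveʳ eq) = ms , zs≡ , cong suc len

  chord-shorter : ∀ xs (a m : A) bs b zs → length (xs ++ a ∷ b ∷ zs) < length (xs ++ a ∷ m ∷ bs ++ b ∷ zs)
  chord-shorter []       a m bs b zs = s≤s (s≤s (≤-trans (m≤n+m _ (length bs)) (≤-reflexive (sym (length-++ bs)))))
  chord-shorter (x ∷ xs) a m bs b zs = s≤s (chord-shorter xs a m bs b zs)

  loop-shorter : ∀ as (w : A) bs cs → length (w ∷ bs) < length (as ++ w ∷ bs ++ w ∷ cs)
  loop-shorter as w bs cs = subst (_ <_) (sym (length-loop as w bs cs)) (m<m+n _ rest-nonempty)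
    where
    rest-nonempty : 0 < length (as ++ w ∷ cs)
    rest-nonempty = ≤-trans (s≤s z≤n) (≤-trans (m≤n+m _ (length as)) (≤-reflexive (sym (length-++ as))))

  rest-shorter : ∀ as (w : A) bs cs → length (as ++ w ∷ cs) < length (as ++ w ∷ bs ++ w ∷ cs)
  rest-shorter as w bs cs = subst (_ <_) (sym (length-loop as w bs cs)) (m<n+m _ (s≤s z≤n))

  listsUpTo : List A → ℕ → List (List A)
  listsUpTo U zero    = [ [] ]
  listsUpTo U (suc k) = [] ∷ cartesianProductWith _∷_ U (listsUpTo U k)

  ∈-listsUpTo : ∀ {U} → (∀ x → x ∈ U) → ∀ {k} xs → length xs ≤ k → xs ∈ listsUpTo U k
  ∈-listsUpTo U-full {zero}  []       _        = here refl
  ∈-listsUpTo U-full {suc k} []       _        = here refl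
  ∈-listsUpTo U-full {suc k} (x ∷ xs) (s≤s le) = there (∈-cartesianProductWith⁺ _∷_ (U-full x) (∈-listsUpTo U-full xs le))

module _ {A : Set} (_≟_ : DecidableEquality A) where

  indexOf : A → List A → ℕ
  indexOf w []       = 0
  indexOf w (x ∷ xs) with w ≟ x
  ... | yes _ = 0
  ... | no  _ = suc (indexOf w xs)

  split-at-indexOf : ∀ {w} xs → w ∈ xs → ∃₂ λ ys zs → xs ≡ ys ++ w ∷ zs × length ys ≡ indexOf w xs
  split-at-indexOf {w} (x ∷ xs) w∈ with w ≟ x
  ... | yes refl = [] , xs , refl , refl
  ... | no w≢x with ys , zs , refl , len ← split-at-indexOf xs (Any.tail w≢x w∈) = x ∷ ys , zs , refl , cong suc len

  indexOf-injective : ∀ {a b} xs → a ∈ xs → b ∈ xs → indexOf a xs ≡ indexOf b xs → a ≡ b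
  indexOf-injective {a} {b} (x ∷ xs) a∈ b∈ eq with a ≟ x | b ≟ x
  ... | yes refl | yes refl = refl
  ... | no a≢x   | no b≢x   = indexOf-injective xs (Any.tail a≢x a∈) (Any.tail b≢x b∈) (suc-injective eq)

∈⇒0<length : ∀ {A : Set} {x : A} {xs} → x ∈ xs → 0 < length xs
∈⇒0<length (here _)  = s≤s z≤n
∈⇒0<length (there _) = s≤s z≤n

module _ {n : ℕ} (G : SignedGraph n) where
  open SignedGraph G renaming (sym to edge-sym)

  adj-sym : ∀ {a b} → Adj G a b → Adj G b a
  adj-sym {a} {b} (ℓ , ab) = ℓ , trans (edge-sym b a) ab

  adj-irrefl : ∀ {a} → ¬ Adj G a a
  adj-irrefl {a} (ℓ , aa) = case trans (sym (irrefl a)) aa of λ ()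

  signE-just : ∀ {x y ℓ} → edge x y ≡ just ℓ → signE G x y ≡ ℓ
  signE-just e rewrite e = refl

  signE-sym : ∀ x y → signE G x y ≡ signE G y x
  signE-sym x y rewrite edge-sym x y = refl

  minus^-negE : ∀ x y → minus^ negE G x y ≡ signE G x y
  minus^-negE x y with edge x y
  ... | just plus  = refl
  ... | just minus = refl
  ... | nothing    = refl

  minus^-negCount : ∀ L → minus^ negCount G L ≡ signP G L
  minus^-negCount []           = refl
  minus^-negCount (x ∷ [])     = refl
  minus^-negCount (x ∷ y ∷ L) =
    trans (minus^-+ (negE G x y) _) (cong₂ _·_ (minus^-negE x y) (minus^-negCount (y ∷ L)))

  signP-backAndForth : ∀ x y → signP G (x ∷ y ∷ x ∷ []) ≡ plus
  signP-backAndForth x y = trans (cong (signE G x y ·_) (trans (·-identityʳ _) (signE-sym y x))) (·-selfInverse (signE G x y))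

  chain-++⁻ : ∀ xs y ys → Chain G (xs ++ y ∷ ys) → Chain G (xs ++ [ y ]) × Chain G (y ∷ ys)
  chain-++⁻ []            y ys c         = tt , c
  chain-++⁻ (x ∷ [])      y ys (xy , c)  = (xy , tt) , c
  chain-++⁻ (x ∷ x' ∷ xs) y ys (xx' , c) with chain-++⁻ (x' ∷ xs) y ys c
  ... | c₁ , c₂ = (xx' , c₁) , c₂

  chain-++⁺ : ∀ xs y ys → Chain G (xs ++ [ y ]) → Chain G (y ∷ ys) → Chain G (xs ++ y ∷ ys)
  chain-++⁺ []            y ys _          c₂ = c₂
  chain-++⁺ (x ∷ [])      y ys (xy , _)   c₂ = xy , c₂
  chain-++⁺ (x ∷ x' ∷ xs) y ys (xx' , c₁) c₂ = xx' , chain-++⁺ (x' ∷ xs) y ys c₁ c₂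

  signP-++ : ∀ xs y ys → signP G (xs ++ y ∷ ys) ≡ signP G (xs ++ [ y ]) · signP G (y ∷ ys)
  signP-++ []            y ys = refl
  signP-++ (x ∷ [])      y ys = cong (_· signP G (y ∷ ys)) (sym (·-identityʳ (signE G x y)))
  signP-++ (x ∷ x' ∷ xs) y ys =
    trans (cong (signE G x x' ·_) (signP-++ (x' ∷ xs) y ys)) (sym (·-assoc (signE G x x') _ _))

  chain-snoc : ∀ {v u} P → Chain G P → last P ≡ just v → Adj G v u → Chain G (P ++ [ u ])
  chain-snoc (x ∷ [])      _          refl vu = vu , tt
  chain-snoc (x ∷ x' ∷ P) (xx' , c) l    vu = xx' , chain-snoc (x' ∷ P) c l vu

  signP-snoc : ∀ {v u} P → last P ≡ just v → signP G (P ++ [ u ]) ≡ signP G P · signE G v u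
  signP-snoc {u = u} (x ∷ []) refl = ·-identityʳ (signE G x u)
  signP-snoc (x ∷ x' ∷ P) l =
    trans (cong (signE G x x' ·_) (signP-snoc (x' ∷ P) l)) (sym (·-assoc (signE G x x') _ _))

  -- The walk L ++ [ y ] returns to y = head L; as in NegCycle, the return is not part of L.
  NegClosedWalk : List (V G) → V G → Set
  NegClosedWalk L y = head L ≡ just y × Chain G (L ++ [ y ]) × signP G (L ++ [ y ]) ≡ minus

  NegCycleIn : List (V G) → Set
  NegCycleIn S = ∃ λ C → All (_∈ S) C × NegCycle G C

  chain-loop : ∀ as w bs ds → Chain G (as ++ w ∷ bs ++ w ∷ ds) → Chain G (w ∷ bs ++ [ w ]) × Chain G (as ++ w ∷ ds)
  chain-loop as w bs ds ch with chain-++⁻ as w (bs ++ w ∷ ds) ch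
  ... | pre , post with chain-++⁻ (w ∷ bs) w ds post
  ...   | loop , suf = loop , chain-++⁺ as w ds pre suf

  signP-loop : ∀ as w bs ds → signP G (as ++ w ∷ bs ++ w ∷ ds) ≡ signP G (w ∷ bs ++ [ w ]) · signP G (as ++ w ∷ ds)
  signP-loop as w bs ds = begin
    signP G (as ++ w ∷ bs ++ w ∷ ds) ≡⟨ signP-++ as w (bs ++ w ∷ ds) ⟩
    s · signP G (w ∷ bs ++ w ∷ ds)   ≡⟨ cong (s ·_) (signP-++ (w ∷ bs) w ds) ⟩
    s · (loop · t)                    ≡⟨ ·-leftComm s loop t ⟩
    loop · (s · t)                    ≡⟨ cong (loop ·_) (sym (signP-++ as w ds)) ⟩
    loop · signP G (as ++ w ∷ ds)    ∎
    where
    open ≡-Reasoning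
    s = signP G (as ++ [ w ])
    loop = signP G (w ∷ bs ++ [ w ])
    t = signP G (w ∷ ds)

  negClosedWalk-cutLoop : ∀ as w bs cs {y} → NegClosedWalk (as ++ w ∷ bs ++ w ∷ cs) y →
    NegClosedWalk (w ∷ bs) w ⊎ NegClosedWalk (as ++ w ∷ cs) y
  negClosedWalk-cutLoop as w bs cs {y} (hd , ch , negative) =
    Sum.map (λ loop⁻ → refl , proj₁ chains , loop⁻)
            (λ rest⁻ → trans (head-++-∷ as w cs (bs ++ w ∷ cs)) hd , rest-chain , rest⁻)
            (·≡minus _ _ (trans (sym signs) negative))
    where
    open ≡-Reasoning
    reassoc = ++-loop-assoc as w bs cs [ y ]
    unassoc = sym (++-assoc as (w ∷ cs) [ y ])
    chains = chain-loop as w bs (cs ++ [ y ]) (subst (Chain G) reassoc ch)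
    rest-chain : Chain G ((as ++ w ∷ cs) ++ [ y ])
    rest-chain = subst (Chain G) unassoc (proj₂ chains)
    loop = signP G (w ∷ bs ++ [ w ])
    signs : signP G ((as ++ w ∷ bs ++ w ∷ cs) ++ [ y ]) ≡ loop · signP G ((as ++ w ∷ cs) ++ [ y ])
    signs = begin
      signP G ((as ++ w ∷ bs ++ w ∷ cs) ++ [ y ]) ≡⟨ cong (signP G) reassoc ⟩
      signP G (as ++ w ∷ bs ++ w ∷ cs ++ [ y ])   ≡⟨ signP-loop as w bs (cs ++ [ y ]) ⟩
      loop · signP G (as ++ w ∷ cs ++ [ y ])      ≡⟨ cong (λ L → loop · signP G L) unassoc ⟩
      loop · signP G ((as ++ w ∷ cs) ++ [ y ])    ∎

  unique-negClosedWalk⇒negCycle : ∀ L {y} → Unique L → NegClosedWalk L y → NegCycle G L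
  unique-negClosedWalk⇒negCycle []              _ (() , _)
  unique-negClosedWalk⇒negCycle (z ∷ [])        _ (refl , (zz , _) , _) = ⊥-elim (adj-irrefl zz)
  unique-negClosedWalk⇒negCycle (z ∷ a ∷ [])    _ (refl , _ , negative) =
    ⊥-elim (plus≢minus (trans (sym (signP-backAndForth z a)) negative))
  unique-negClosedWalk⇒negCycle (z ∷ a ∷ b ∷ L) unique (refl , ch , negative) =
    (unique , s≤s (s≤s (s≤s z≤n)) , ch) , minus^≡minus⇒odd (negCount G W) (trans (minus^-negCount W) negative)
    where
    W = z ∷ a ∷ b ∷ L ++ [ z ]

  negClosedWalk⇒negCycleIn : ∀ {S} L {y} → Acc _<_ (length L) → All (_∈ S) L → NegClosedWalk L y → NegCycleIn S
  negClosedWalk⇒negCycleIn L (acc shorter) L⊆S walk with unique⊎repeats _≟ᶠ_ L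
  ... | inj₁ unique = L , L⊆S , unique-negClosedWalk⇒negCycle L unique walk
  ... | inj₂ (repeats as w bs cs) with negClosedWalk-cutLoop as w bs cs walk
  ...   | inj₁ loop = negClosedWalk⇒negCycleIn (w ∷ bs) (shorter (loop-shorter as w bs cs))
                        (proj₁ (All-loop as w bs cs L⊆S)) loop
  ...   | inj₂ rest = negClosedWalk⇒negCycleIn (as ++ w ∷ cs) (shorter (rest-shorter as w bs cs))
                        (proj₂ (All-loop as w bs cs L⊆S)) rest

  chord-shortcut : ∀ {u v} xs a m bs b zs → IsPath G u v (xs ++ a ∷ m ∷ bs ++ b ∷ zs) → Adj G a b →
    IsPath G u v (xs ++ a ∷ b ∷ zs)
  chord-shortcut xs a m bs b zs (hd , ls , ch) ab =
    trans (head-++-∷ xs a _ _) hd ,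
    trans (last-++-∷ xs a _) (trans (sym (last-++-∷ (m ∷ bs) b zs)) (trans (sym (last-++-∷ xs a _)) ls)) ,
    chain-++⁺ xs a (b ∷ zs) (proj₁ split) (ab , proj₂ (chain-++⁻ (a ∷ m ∷ bs) b zs (proj₂ split)))
    where
    split = chain-++⁻ xs a (m ∷ bs ++ b ∷ zs) ch

  shortest⇒chordless : ∀ {u v} xs a m bs b zs → Shortest G u v (xs ++ a ∷ m ∷ bs ++ b ∷ zs) → ¬ Adj G a b
  shortest⇒chordless xs a m bs b zs (path , minimal) ab =
    <⇒≱ (chord-shorter xs a m bs b zs) (minimal _ (chord-shortcut xs a m bs b zs path ab))

  indexOf-adjacent : ∀ {u v a b} P → Shortest G u v P → a ∈ P → b ∈ P → Adj G a b →
    indexOf _≟ᶠ_ a P < indexOf _≟ᶠ_ b P → indexOf _≟ᶠ_ b P ≡ suc (indexOf _≟ᶠ_ a P)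
  indexOf-adjacent P shortest a∈ b∈ ab i<j
    with ys , zs , refl , i≡ ← split-at-indexOf _≟ᶠ_ P a∈
    with ys' , zs' , eq , j≡ ← split-at-indexOf _≟ᶠ_ _ b∈
    with split-between ys zs ys' zs' (subst₂ _<_ (sym i≡) (sym j≡) i<j) eq
  ... | []     , refl , len = trans (sym j≡) (trans len (trans (+-comm _ 1) (cong suc i≡)))
  ... | m ∷ bs , refl , _   = ⊥-elim (shortest⇒chordless ys _ m bs _ zs' shortest ab)

  indexOf-step : ∀ {u v a b} P → Shortest G u v P → a ∈ P → b ∈ P → Adj G a b →
    indexOf _≟ᶠ_ b P ≡ suc (indexOf _≟ᶠ_ a P) ⊎ indexOf _≟ᶠ_ a P ≡ suc (indexOf _≟ᶠ_ b P)
  indexOf-step {a = a} {b} P shortest a∈ b∈ ab with <-cmp (indexOf _≟ᶠ_ a P) (indexOf _≟ᶠ_ b P)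
  ... | tri< i<j _ _ = inj₁ (indexOf-adjacent P shortest a∈ b∈ ab i<j)
  ... | tri≈ _ i≡j _ = ⊥-elim (adj-irrefl (subst (Adj G a) (sym (indexOf-injective _≟ᶠ_ P a∈ b∈ i≡j)) ab))
  ... | tri> _ _ j<i = inj₂ (indexOf-adjacent P shortest b∈ a∈ (adj-sym ab) j<i)

  module Graded (S : List (V G)) (f : V G → ℕ)
    (f-injective : ∀ {a b} → a ∈ S → b ∈ S → f a ≡ f b → a ≡ b)
    (f-step : ∀ {a b} → a ∈ S → b ∈ S → Adj G a b → f b ≡ suc (f a) ⊎ f a ≡ suc (f b)) where

    _↗_ : V G → V G → Set
    a ↗ b = f b ≡ suc (f a)

    Ascending Descending : List (V G) → Set
    Ascending  = Linked _↗_
    Descending = Linked (flip _↗_)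

    ascending⊎descending : ∀ L → Chain G L → Unique L → All (_∈ S) L → Ascending L ⊎ Descending L
    ascending⊎descending []           _        _ _             = inj₁ []
    ascending⊎descending (x ∷ [])     _        _ _             = inj₁ [-]
    ascending⊎descending (x ∷ y ∷ []) (xy , _) _ (x∈ ∷ y∈ ∷ _) = Sum.map (_∷ [-]) (_∷ [-]) (f-step x∈ y∈ xy)
    ascending⊎descending (x ∷ y ∷ z ∷ L) (xy , ch) (x∉ ∷ unique) (x∈ ∷ L⊆S)
      with f-step x∈ (All.head L⊆S) xy | ascending⊎descending (y ∷ z ∷ L) ch unique L⊆S
    ... | inj₁ x↗y | inj₁ asc        = inj₁ (x↗y ∷ asc)
    ... | inj₂ y↗x | inj₂ desc       = inj₂ (y↗x ∷ desc)
    -- a change of direction at y would give the distinct nodes x and z the same value of f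
    ... | inj₁ x↗y | inj₂ (z↗y ∷ _) =
      ⊥-elim (All.head (All.tail x∉) (f-injective x∈ (All.head (All.tail L⊆S)) (suc-injective (trans (sym x↗y) z↗y))))
    ... | inj₂ y↗x | inj₁ (y↗z ∷ _) =
      ⊥-elim (All.head (All.tail x∉) (f-injective x∈ (All.head (All.tail L⊆S)) (trans y↗x (sym y↗z))))

    ascending-< : ∀ {x z} ys → Ascending (x ∷ ys ++ [ z ]) → f x < f z
    ascending-< []       (x↗z ∷ [-]) = ≤-reflexive (sym x↗z)
    ascending-< (y ∷ ys) (x↗y ∷ asc) = <-trans (≤-reflexive (sym x↗y)) (ascending-< ys asc)

    descending-< : ∀ {x z} ys → Descending (x ∷ ys ++ [ z ]) → f z < f x
    descending-< []       (z↗x ∷ [-])  = ≤-reflexive (sym z↗x)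
    descending-< (y ∷ ys) (y↗x ∷ desc) = <-trans (descending-< ys desc) (≤-reflexive (sym y↗x))

    far⇒¬adjacent : ∀ {a b} → a ∈ S → b ∈ S → suc (f a) < f b → ¬ Adj G a b
    far⇒¬adjacent a∈ b∈ far ab with f-step a∈ b∈ ab
    ... | inj₁ a↗b = <-irrefl (sym a↗b) far
    ... | inj₂ b↗a = <-asym (<-trans (n<1+n _) far) (≤-reflexive (sym b↗a))

    ¬closing-edge : ∀ {x y z} ys → Unique (x ∷ y ∷ ys ++ [ z ]) → Chain G (x ∷ y ∷ ys ++ [ z ]) →
      All (_∈ S) (x ∷ y ∷ ys ++ [ z ]) → ¬ Adj G z x
    ¬closing-edge {x} {y} {z} ys unique ch C⊆S =
      [ (λ { (x↗y ∷ asc) → far⇒¬adjacent x∈ z∈ (subst (_< f z) x↗y (ascending-< ys asc)) ∘ adj-sym })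
      , (λ { (y↗x ∷ desc) → far⇒¬adjacent z∈ x∈ (subst (suc (f z) <_) (sym y↗x) (s≤s (descending-< ys desc))) })
      ]′ (ascending⊎descending _ ch unique C⊆S)
      where
      x∈ = All.head C⊆S
      z∈ = All.head (++⁻ʳ (x ∷ y ∷ ys) C⊆S)

    acyclic : ∀ C → All (_∈ S) C → ¬ IsCycle G C
    acyclic (x ∷ xs) C⊆S cycle with initLast xs
    acyclic (x ∷ .[])                  _   (_ , s≤s () , _)       | []
    acyclic (x ∷ .([] ++ [ z ]))       _   (_ , s≤s (s≤s ()) , _) | [] ∷ʳ′ z
    acyclic (x ∷ .((y ∷ ys) ++ [ z ])) C⊆S (unique , _ , ch)      | (y ∷ ys) ∷ʳ′ z =
      ¬closing-edge ys unique (proj₁ split) C⊆S (proj₁ (proj₂ split))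
      where
      split = chain-++⁻ (x ∷ y ∷ ys) z [ x ] (subst (Chain G) (++-assoc (x ∷ y ∷ ys) [ z ] [ x ]) ch)

  shortest⇒balanced : ∀ {u v P} → Shortest G u v P → BalancedPath G P
  shortest⇒balanced {P = P} shortest (x ∷ xs , C⊆P , cycle , _) =
    Graded.acyclic P (λ w → indexOf _≟ᶠ_ w P) (indexOf-injective _≟ᶠ_ P) (indexOf-step P shortest) (x ∷ xs) C⊆P cycle

  adj? : ∀ x y → Dec (Adj G x y)
  adj? x y with edge x y
  ... | just ℓ  = yes (ℓ , refl)
  ... | nothing = no λ { (_ , ()) }

  chain? : Decidable (Chain G)
  chain? []          = yes tt
  chain? (x ∷ [])    = yes tt
  chain? (x ∷ y ∷ L) = adj? x y ×-dec chain? (y ∷ L)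

  isPath? : ∀ u v → Decidable (IsPath G u v)
  isPath? u v P = ≡-decᴹ _≟ᶠ_ (head P) (just u) ×-dec (≡-decᴹ _≟ᶠ_ (last P) (just v) ×-dec chain? P)

  shortest? : ∀ {u v P₀} → Shortest G u v P₀ → Decidable (Shortest G u v)
  shortest? {u} {v} {P₀} (path₀ , minimal₀) P =
    map′ (λ (path , P≤P₀) → path , λ Q q → ≤-trans P≤P₀ (minimal₀ Q q))
         (λ (path , minimal) → path , minimal P₀ path₀)
         (isPath? u v P ×-dec length P ≤? length P₀)

  shortestPath : Connected G → ∀ u v → ∃ (Shortest G u v)
  shortestPath connected u v =
    argmin length P₀ candidates , argmin-all length path₀ (all-filter (isPath? u v) short) , minimal
    where
    P₀ = proj₁ (connected u v)
    path₀ = proj₂ (connected u v)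
    short = listsUpTo (allFin n) (length P₀)
    candidates = filter (isPath? u v) short
    minimal : ∀ Q → IsPath G u v Q → length (argmin length P₀ candidates) ≤ length Q
    minimal Q q with length Q ≤? length P₀
    ... | yes Q≤P₀ = f[argmin]≤v⁺ {f = length} P₀ candidates
                       (inj₂ (lose (∈-filter⁺ (isPath? u v) (∈-listsUpTo ∈-allFin Q Q≤P₀) q) ≤-refl))
    ... | no  Q≰P₀ = ≤-trans (f[argmin]≤f[⊤] {f = length} P₀ candidates) (<⇒≤ (≰⇒> Q≰P₀))

  hasCard-empty : ∀ {A} → (∀ P → ¬ A P) → HasCard G A 0
  hasCard-empty ¬A = [] , [] , (λ P → (λ ()) , λ a → ⊥-elim (¬A P a)) , refl

  hasCard-bounded : ∀ {A} → Decidable A → ∀ k → (∀ {P} → A P → length P ≤ k) → ∃ (HasCard G A)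
  hasCard-bounded {A} A? k bounded = length L , L , deduplicate-! (≡-decᴸ _≟ᶠ_) candidates , members , refl
    where
    candidates = filter A? (listsUpTo (allFin n) k)
    L = deduplicate (≡-decᴸ _≟ᶠ_) candidates
    members : ∀ P → (P ∈ L → A P) × (A P → P ∈ L)
    members P =
      (λ P∈L → proj₂ (∈-filter⁻ A? {xs = listsUpTo (allFin n) k} (∈-deduplicate⁻ (≡-decᴸ _≟ᶠ_) candidates P∈L))) ,
      (λ a → ∈-deduplicate⁺ (≡-decᴸ _≟ᶠ_) (∈-filter⁺ A? (∈-listsUpTo ∈-allFin P (bounded a)) a))

  hasCard⇒0< : ∀ {A k P} → HasCard G A k → A P → 0 < k
  hasCard⇒0< (_ , _ , members , refl) a = ∈⇒0<length (proj₂ (members _) a)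

  hasCard-witness : ∀ {A k} → HasCard G A k → 0 < k → ∃ A
  hasCard-witness (P ∷ _ , _ , members , refl) _ = P , proj₁ (members P) (here refl)

  CompDPE⊆CompSPA : _⊆ᵣ_ G (CompDPE G) (CompSPA G)
  CompDPE⊆CompSPA u v uv⁺ []              ((() , _) , _)
  CompDPE⊆CompSPA u v uv⁺ (x ∷ [])        ((refl , refl , _) , _) = ⊥-elim (adj-irrefl (plus , uv⁺))
  CompDPE⊆CompSPA u v uv⁺ (x ∷ y ∷ [])    ((refl , refl , _) , _) = trans (·-identityʳ _) (signE-just uv⁺)
  CompDPE⊆CompSPA u v uv⁺ (x ∷ y ∷ z ∷ _) (_ , minimal) =
    case minimal (u ∷ v ∷ []) (refl , refl , (plus , uv⁺) , tt) of λ { (s≤s (s≤s ())) }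

  CompSPA⊆CompSPM : Connected G → _⊆ᵣ_ G (CompSPA G) (CompSPM G)
  CompSPA⊆CompSPM connected u v allPositive =
    let (P₀ , shortest₀) = shortestPath connected u v
        (p , positives) = hasCard-bounded (λ P → shortest? shortest₀ P ×-dec (signP G P ≟ˢ plus)) (length P₀)
                                          (λ (shortest , _) → proj₂ shortest P₀ (proj₁ shortest₀))
    in p , 0 , positives , hasCard-empty (λ P (shortest , P⁻) → plus≢minus (trans (sym (allPositive P shortest)) P⁻)) , z≤n

  CompSPM⊆CompSPO : Connected G → _⊆ᵣ_ G (CompSPM G) (CompSPO G)
  CompSPM⊆CompSPO connected u v (p , m , positives , negatives , m≤p) with shortestPath connected u v
  ... | P , shortest with signP G P in sign
  ...   | plus  = P , shortest , sign
  ...   | minus = hasCard-witness positives (<-≤-trans (hasCard⇒0< negatives (shortest , sign)) m≤p)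

  CompSPO⊆CompSBP : _⊆ᵣ_ G (CompSPO G) (CompSBP G)
  CompSPO⊆CompSBP u v (P , shortest , P⁺) = P , proj₁ shortest , shortest⇒balanced shortest , P⁺

  CompSBP⊆CompNNE : _⊆ᵣ_ G (CompSBP G) (CompNNE G)
  CompSBP⊆CompNNE u v (P , (hd , ls , ch) , balanced , P⁺) uv⁻ =
    balanced (negClosedWalk⇒negCycleIn P (<-wellFounded _) (All.tabulate id) (hd , chain-snoc P ch ls (minus , vu⁻) , negative))
    where
    vu⁻ : edge v u ≡ just minus
    vu⁻ = trans (edge-sym v u) uv⁻
    negative : signP G (P ++ [ u ]) ≡ minus
    negative = trans (signP-snoc P ls) (cong₂ _·_ P⁺ (signE-just vu⁻))

proposition3p6 : (n : ℕ) (G : SignedGraph n) → Connected G →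
    _⊆ᵣ_ G (CompDPE G) (CompSPA G) × _⊆ᵣ_ G (CompSPA G) (CompSPM G) ×
    _⊆ᵣ_ G (CompSPM G) (CompSPO G) × _⊆ᵣ_ G (CompSPO G) (CompSBP G) ×
    _⊆ᵣ_ G (CompSBP G) (CompNNE G)
proposition3p6 n G connected =
  CompDPE⊆CompSPA G , CompSPA⊆CompSPM G connected , CompSPM⊆CompSPO G connected , CompSPO⊆CompSBP G , CompSBP⊆CompNNE G
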